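{- If $H$ is a subgraph of a graph $G$, then $\mathrm{cat}(H)\leq \mathrm{cat}(G)$. Further, if $v\in V(H)$, then $\mathrm{cat}(H,v)\leq \mathrm{cat}(G,v)$.
   Context: Cat Herding is a two-player game on a finite simple graph $G$ between a cat and a herder. First the cat places its token on a starting vertex. Then the players alternate, the herder moving first: on the herder's turn it deletes one edge of the current graph (a "cut"); on the cat's turn the cat must move its token along a path of the current graph to a different vertex. The game ends when the cat's current vertex has no incident edges. The score is the total number of edges deleted; the herder minimizes and the cat maximizes it. For $v\in V(G)$, $\mathrm{cat}(G,v)$ is the optimal-play score when the cat starts at $v$, and $\mathrm{cat}(G)=\max_{v\in V(G)}\mathrm{cat}(G,v)$. -}

module Defs where

open import Data.Nat using (ℕ; zero; suc; _⊔_; _⊓_)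
open import Data.Fin using (Fin; _≟_) renaming (_<_ to _<ᶠ_)
open import Data.List using (List; []; _∷_; map; foldr; filter; length; allFin)
open import Data.Bool.ListAction using (any)
open import Data.List.Relation.Unary.All using (All)
open import Data.List.Relation.Unary.Unique.Propositional using (Unique)
open import Data.List.Membership.Propositional using (_∈_)
open import Data.Bool using (Bool; true; false; _∧_; _∨_; not; if_then_else_; T)
open import Data.Product using (_×_; _,_; proj₁; proj₂)
open import Data.Sum using (_⊎_)
open import Relation.Nullary.Decidable using (⌊_⌋)
open import Relation.Binary.PropositionalEquality using (_≡_)
open import Function.Definitions using (Injective)

-- Vertex set Fin n; an (undirected) edge {a,b} is stored once as the
-- ordered pair (a , b) with a < b (so no loops); the edge list has no
-- repetitions (so no multi-edges).

Edge : ℕ → Set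
Edge n = Fin n × Fin n

record Graph : Set where
  field
    n        : ℕ
    edges    : List (Edge n)
    loopless : All (λ e → proj₁ e <ᶠ proj₂ e) edges
    distinct : Unique edges
open Graph public

Adj : (G : Graph) → Fin (n G) → Fin (n G) → Set
Adj G a b = ((a , b) ∈ edges G) ⊎ ((b , a) ∈ edges G)

record Subgraph (H G : Graph) : Set where
  field
    emb      : Fin (n H) → Fin (n G)
    emb-inj  : Injective _≡_ _≡_ emb
    emb-adj  : ∀ a b → Adj H a b → Adj G (emb a) (emb b)
open Subgraph public

module _ {n : ℕ} where

  incident : Fin n → Edge n → Bool
  incident v (a , b) = ⌊ v ≟ a ⌋ ∨ ⌊ v ≟ b ⌋

  isolated : List (Edge n) → Fin n → Bool
  isolated E v = not (any (incident v) E)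

  reach : ℕ → List (Edge n) → Fin n → Fin n → Bool
  reach zero    E v x = ⌊ x ≟ v ⌋
  reach (suc k) E v x = reach k E v x ∨
    any (λ { (a , b) → (⌊ a ≟ x ⌋ ∧ reach k E v b) ∨ (⌊ b ≟ x ⌋ ∧ reach k E v a) }) E

  -- x is joined to v by a path in the graph (Fin n , E)
  -- (paths of length ≤ n suffice in an n-vertex graph)
  connected : List (Edge n) → Fin n → Fin n → Bool
  connected E v x = reach n E v x

  moves : List (Edge n) → Fin n → List (Fin n)
  moves E v = filter (λ w → T? (connected E v w ∧ not ⌊ w ≟ v ⌋)) (allFin n)
    where
    open import Data.Bool.Properties using () renaming (T? to T?)

picks : {A : Set} → List A → List (A × List A)
picks []       = []
picks (x ∷ xs) = (x , xs) ∷ map (λ { (y , ys) → (y , x ∷ ys) }) (picks xs)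

maxList : List ℕ → ℕ
maxList = foldr _⊔_ 0

minList : List ℕ → ℕ
minList []       = 0
minList (x ∷ xs) = foldr _⊓_ x xs

-- Value of the game (remaining number of cuts under optimal play).
-- herderVal k E v : herder to move, current edges E, cat at v.
-- catVal   k E v : cat to move, current edges E, cat at v.
-- k is fuel, always equal to length E when called from catValue below
-- (every cut removes exactly one edge), so it never runs out early.
mutual
  herderVal : {n : ℕ} → ℕ → List (Edge n) → Fin n → ℕ
  herderVal zero    E v = 0
  herderVal (suc k) E v =
    if isolated E v then 0
    else minList (map (λ { (e , E′) → suc (catVal k E′ v) }) (picks E))

  catVal : {n : ℕ} → ℕ → List (Edge n) → Fin n → ℕ
  catVal k E v =
    if isolated E v then 0
    else maxList (map (herderVal k E) (moves E v))

catValue : (G : Graph) → Fin (n G) → ℕ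
catValue G v = herderVal (length (edges G)) (edges G) v

catMax : Graph → ℕ
catMax G = maxList (map (catValue G) (allFin (n G)))

{-# OPTIONS --safe #-}
-- The herder on H imitates the herder on G: when G loses the edge e, H loses the H-edge
-- whose image is e, or an arbitrary edge if there is none.  This keeps every current
-- H-edge mapped onto a current G-edge, so a non-isolated cat in H is non-isolated in G
-- and every cat move in H is, through the embedding, a cat move in G; induction on the
-- game then bounds the H-value by the G-value.  Because edges are stored once and
-- oriented (a < b), an injective embedding sends at most one H-edge onto e.
module Submission where

open import Defs
open import Data.Nat using (_≤_)
open import Data.Product using (_×_)

open import Data.Bool using (true; false; not; _∧_; _∨_; if_then_else_; T)
open import Data.Bool.Properties using (T-≡; T-∧; T-∨; not-injective)
open import Data.Empty using (⊥-elim)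
open import Data.Unit using (tt)
open import Data.Fin using (Fin; _≟_) renaming (_<_ to _<ᶠ_)
open import Data.Fin.Properties using (injective⇒≤) renaming (<-asym to <ᶠ-asym)
open import Data.List using (List; []; _∷_; map; foldr; length; allFin)
open import Data.List.Membership.Propositional using (_∈_; find; lose)
open import Data.List.Membership.Propositional.Properties
  using (∈-map⁺; ∈-map⁻; ∈-filter⁺; ∈-filter⁻; ∈-allFin)
open import Data.List.Relation.Binary.Permutation.Propositional
  using (_↭_; ↭⇒↭ₛ; ↭-refl; ↭-prep; ↭-swap; ↭-trans; ↭-sym)
open import Data.List.Relation.Binary.Permutation.Propositional.Properties
  using (∈-resp-↭; All-resp-↭; ↭-length)
open import Data.List.Relation.Binary.Permutation.Setoid.Properties using (Unique-resp-↭)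
open import Data.List.Relation.Unary.All as All using (All; []; _∷_)
import Data.List.Relation.Unary.All.Properties as All
open import Data.List.Relation.Unary.Any using (Any; here; there; any?)
open import Data.List.Relation.Unary.Any.Properties using (any⁺; any⁻)
open import Data.List.Relation.Unary.Unique.Propositional as Unique using (Unique)
open import Data.Nat using (ℕ; zero; suc; _⊓_; z≤n; s≤s; _≤′_; ≤′-refl; ≤′-step)
open import Data.Nat.Properties
  using (≤-refl; ≤-trans; ⊔-lub; m≤m⊔n; m≤n⊔m; m⊓n≤m; m⊓n≤n; ⊓-glb; ≤⇒≤′; suc-injective)
open import Data.Product using (∃; ∃₂; _,_; proj₂; swap)
open import Data.Product.Properties using (≡-dec; ,-injective)
open import Data.Sum as Sum using (_⊎_; inj₁; inj₂)
open import Function using (Injective; Equivalence; _∘_)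
open import Relation.Binary.PropositionalEquality using (_≡_; _≢_; refl; sym; cong; cong₂)
open import Relation.Binary.PropositionalEquality.Properties using (setoid)
open import Relation.Nullary using (¬_; Dec; yes; no)
open import Relation.Nullary.Decidable
  using (⌊_⌋; toWitness; fromWitness; toWitnessFalse; fromWitnessFalse; _⊎-dec_)

open Equivalence using (to; from)

maxList-ub : ∀ {x xs} → x ∈ xs → x ≤ maxList xs
maxList-ub {xs = y ∷ ys} (here refl) = m≤m⊔n y (maxList ys)
maxList-ub {xs = y ∷ ys} (there x∈ys) = ≤-trans (maxList-ub x∈ys) (m≤n⊔m y (maxList ys))

maxList-lub : ∀ {m xs} → All (_≤ m) xs → maxList xs ≤ m
maxList-lub [] = z≤n
maxList-lub (x≤m ∷ xs≤m) = ⊔-lub x≤m (maxList-lub xs≤m)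

maxList-map-mono : ∀ {A B : Set} {f : A → ℕ} {g : B → ℕ} {xs ys} (h : A → B) →
  (∀ {x} → x ∈ xs → h x ∈ ys) → (∀ x → f x ≤ g (h x)) → maxList (map f xs) ≤ maxList (map g ys)
maxList-map-mono h h∈ f≤gh =
  maxList-lub (All.map⁺ (All.tabulate λ x∈ → ≤-trans (f≤gh _) (maxList-ub (∈-map⁺ _ (h∈ x∈)))))

minList-lb : ∀ {x xs} → x ∈ xs → minList xs ≤ x
minList-lb {xs = y ∷ ys} = go y ys
  where
  go : ∀ y ys {x} → x ∈ y ∷ ys → foldr _⊓_ y ys ≤ x
  go y [] (here refl) = ≤-refl
  go y (z ∷ zs) (here refl) = ≤-trans (m⊓n≤n z _) (go y zs (here refl))
  go y (z ∷ zs) (there (here refl)) = m⊓n≤m z _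
  go y (z ∷ zs) (there (there x∈zs)) = ≤-trans (m⊓n≤n z _) (go y zs (there x∈zs))

minList-glb : ∀ {m x xs} → All (m ≤_) (x ∷ xs) → m ≤ minList (x ∷ xs)
minList-glb (m≤x ∷ []) = m≤x
minList-glb (m≤x ∷ m≤y ∷ m≤ys) = ⊓-glb m≤y (minList-glb (m≤x ∷ m≤ys))

minList-map-glb : ∀ {A : Set} {f : A → ℕ} {m} x xs → (∀ {y} → y ∈ x ∷ xs → m ≤ f y) →
  m ≤ minList (map f (x ∷ xs))
minList-map-glb x xs m≤f = minList-glb (All.map⁺ (All.tabulate m≤f))

if0-mono : ∀ {b b′ x y} → (b ≡ false → b′ ≡ false) → x ≤ y →
  (if b then 0 else x) ≤ (if b′ then 0 else y)
if0-mono {true} _ _ = z≤n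
if0-mono {false} b′≡false x≤y rewrite b′≡false refl = x≤y

module _ {A : Set} where

  picks-↭ : ∀ {xs : List A} {x xs′} → (x , xs′) ∈ picks xs → xs ↭ x ∷ xs′
  picks-↭ {y ∷ ys} (here refl) = ↭-refl
  picks-↭ {y ∷ ys} (there p) with ∈-map⁻ _ p
  ... | (x , ys′) , p′ , refl = ↭-trans (↭-prep y (picks-↭ p′)) (↭-swap y x ↭-refl)

  picks-complete : ∀ {xs : List A} {x} → x ∈ xs → ∃ λ xs′ → (x , xs′) ∈ picks xs
  picks-complete {y ∷ ys} (here refl) = ys , here refl
  picks-complete {y ∷ ys} (there x∈ys) with picks-complete x∈ys
  ... | ys′ , p = y ∷ ys′ , there (∈-map⁺ _ p)

  ∈-picks : ∀ {xs : List A} {x xs′ y} → (x , xs′) ∈ picks xs → y ∈ xs → y ≡ x ⊎ y ∈ xs′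
  ∈-picks p y∈xs with ∈-resp-↭ (picks-↭ p) y∈xs
  ... | here y≡x = inj₁ y≡x
  ... | there y∈xs′ = inj₂ y∈xs′

  ∈-picks-rest : ∀ {xs : List A} {x xs′ y} → (x , xs′) ∈ picks xs → y ∈ xs′ → y ∈ xs
  ∈-picks-rest p y∈xs′ = ∈-resp-↭ (↭-sym (picks-↭ p)) (there y∈xs′)

  picks-length : ∀ {xs : List A} {x xs′} → (x , xs′) ∈ picks xs → length xs ≡ suc (length xs′)
  picks-length p = ↭-length (picks-↭ p)

  picks-unique : ∀ {xs : List A} {x xs′} → (x , xs′) ∈ picks xs → Unique xs → Unique (x ∷ xs′)
  picks-unique p = Unique-resp-↭ (setoid A) (↭⇒↭ₛ (picks-↭ p))

module _ {n : ℕ} where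

  Adjacent : List (Edge n) → Fin n → Fin n → Set
  Adjacent E a b = ((a , b) ∈ E) ⊎ ((b , a) ∈ E)

  Adjacent-sym : ∀ {E a b} → Adjacent E a b → Adjacent E b a
  Adjacent-sym = Sum.swap

  T-≟-refl : (a : Fin n) → T ⌊ a ≟ a ⌋
  T-≟-refl a = fromWitness refl

  T-incident⁻ : ∀ {v a b : Fin n} → T (incident v (a , b)) → v ≡ a ⊎ v ≡ b
  T-incident⁻ {v} {a} {b} t with v ≟ a | v ≟ b
  ... | yes v≡a | _       = inj₁ v≡a
  ... | no _    | yes v≡b = inj₂ v≡b

  T-incident⁺ : ∀ {v a b : Fin n} → v ≡ a ⊎ v ≡ b → T (incident v (a , b))
  T-incident⁺ {v} {a} {b} v∈ab with v ≟ a | v ≟ b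
  ... | yes _   | _       = tt
  ... | no _    | yes _   = tt
  ... | no v≢a  | no v≢b  = Sum.[ v≢a , v≢b ] v∈ab

  nonisolated⇒adjacent : ∀ {E : List (Edge n)} {v} → isolated E v ≡ false → ∃ (Adjacent E v)
  nonisolated⇒adjacent {E} {v} nonisolated
    with find (any⁻ (incident v) E (from T-≡ (not-injective {y = true} nonisolated)))
  ... | (a , b) , ab∈E , t with T-incident⁻ {v} {a} {b} t
  ... | inj₁ refl = b , inj₁ ab∈E
  ... | inj₂ refl = a , inj₂ ab∈E

  adjacent⇒nonisolated : ∀ {E : List (Edge n)} {v w} → Adjacent E v w → isolated E v ≡ false
  adjacent⇒nonisolated {E} {v} adj = cong not (to T-≡ (any⁺ (incident v) (incidence adj)))
    where
    incidence : ∀ {w} → Adjacent E v w → Any (T ∘ incident v) E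
    incidence {w} (inj₁ vw∈E) = lose vw∈E (T-incident⁺ {v} {v} {w} (inj₁ refl))
    incidence {w} (inj₂ wv∈E) = lose wv∈E (T-incident⁺ {v} {w} {v} (inj₂ refl))

  reach-suc⁻ : ∀ k {E : List (Edge n)} {v x} → T (reach (suc k) E v x) →
    T (reach k E v x) ⊎ ∃ λ y → Adjacent E x y × T (reach k E v y)
  reach-suc⁻ k {E} {v} {x} r with to T-∨ r
  ... | inj₁ r′ = inj₁ r′
  ... | inj₂ r′ with find (any⁻ _ E r′)
  ... | (a , b) , ab∈E , t = inj₂ (via ab∈E t)
    where
    via : ∀ {a b} → (a , b) ∈ E →
      T ((⌊ a ≟ x ⌋ ∧ reach k E v b) ∨ (⌊ b ≟ x ⌋ ∧ reach k E v a)) →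
      ∃ λ y → Adjacent E x y × T (reach k E v y)
    via {a} {b} ab∈E t with to T-∨ t
    ... | inj₁ t′ with to T-∧ t′
    ... | a≡x , rb with toWitness {a? = a ≟ x} a≡x
    ... | refl = b , inj₁ ab∈E , rb
    via {a} {b} ab∈E t | inj₂ t′ with to T-∧ t′
    ... | b≡x , ra with toWitness {a? = b ≟ x} b≡x
    ... | refl = a , inj₂ ab∈E , ra

  reach-suc⁺ˡ : ∀ k {E : List (Edge n)} {v x} → T (reach k E v x) → T (reach (suc k) E v x)
  reach-suc⁺ˡ k r = from T-∨ (inj₁ r)

  reach-suc⁺ʳ : ∀ k {E : List (Edge n)} {v x y} → Adjacent E x y → T (reach k E v y) →
    T (reach (suc k) E v x)
  reach-suc⁺ʳ k {x = x} (inj₁ xy∈E) r =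
    from T-∨ (inj₂ (any⁺ _ (lose xy∈E (from T-∨ (inj₁ (from T-∧ (T-≟-refl x , r)))))))
  reach-suc⁺ʳ k {x = x} (inj₂ yx∈E) r =
    from T-∨ (inj₂ (any⁺ _ (lose yx∈E (from T-∨ (inj₂ (from T-∧ (T-≟-refl x , r)))))))

  reach-mono : ∀ {k l} {E : List (Edge n)} {v x} → k ≤ l → T (reach k E v x) → T (reach l E v x)
  reach-mono k≤l = go (≤⇒≤′ k≤l)
    where
    go : ∀ {k l} {E : List (Edge n)} {v x} → k ≤′ l → T (reach k E v x) → T (reach l E v x)
    go ≤′-refl r = r
    go (≤′-step {n = l} k≤′l) r = reach-suc⁺ˡ l (go k≤′l r)

  ∈-moves⁻ : ∀ {E : List (Edge n)} {v w} → w ∈ moves E v → T (connected E v w) × w ≢ v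
  ∈-moves⁻ {E} {v} {w} w∈ with to T-∧ (proj₂ (∈-filter⁻ _ {xs = allFin n} w∈))
  ... | c , w≢v = c , toWitnessFalse {a? = w ≟ v} w≢v

  ∈-moves⁺ : ∀ {E : List (Edge n)} {v w} → T (connected E v w) → w ≢ v → w ∈ moves E v
  ∈-moves⁺ c w≢v = ∈-filter⁺ _ (∈-allFin _) (from T-∧ (c , fromWitnessFalse {a? = _ ≟ _} w≢v))

module Embedding {m n : ℕ} (f : Fin m → Fin n) (f-inj : Injective _≡_ _≡_ f) where

  EdgesPreserved : List (Edge m) → List (Edge n) → Set
  EdgesPreserved EH EG = ∀ {a b} → (a , b) ∈ EH → Adjacent EG (f a) (f b)

  module _ {EH : List (Edge m)} {EG : List (Edge n)} (preserved : EdgesPreserved EH EG) where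

    adjacent-preserved : ∀ {a b} → Adjacent EH a b → Adjacent EG (f a) (f b)
    adjacent-preserved (inj₁ ab∈EH) = preserved ab∈EH
    adjacent-preserved (inj₂ ba∈EH) = Adjacent-sym (preserved ba∈EH)

    nonisolated-preserved : ∀ {v} → isolated EH v ≡ false → isolated EG (f v) ≡ false
    nonisolated-preserved nonisolated =
      adjacent⇒nonisolated (adjacent-preserved (proj₂ (nonisolated⇒adjacent nonisolated)))

    reach-preserved : ∀ k {v x} → T (reach k EH v x) → T (reach k EG (f v) (f x))
    reach-preserved zero r = fromWitness (cong f (toWitness r))
    reach-preserved (suc k) r with reach-suc⁻ k r
    ... | inj₁ r′ = reach-suc⁺ˡ k (reach-preserved k r′)
    ... | inj₂ (y , xy , r′) = reach-suc⁺ʳ k (adjacent-preserved xy) (reach-preserved k r′)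

    moves-preserved : ∀ {v w} → w ∈ moves EH v → f w ∈ moves EG (f v)
    moves-preserved w∈ with ∈-moves⁻ w∈
    ... | c , w≢v = ∈-moves⁺ (reach-mono (injective⇒≤ f-inj) (reach-preserved m c)) (w≢v ∘ f-inj)

  Ordered : Edge m → Set
  Ordered (a , b) = a <ᶠ b

  record Embeds (EH : List (Edge m)) (EG : List (Edge n)) : Set where
    field
      unique    : Unique EH
      ordered   : All Ordered EH
      preserved : EdgesPreserved EH EG
  open Embeds

  Realises : Edge n → Edge m → Set
  Realises e (a , b) = e ≡ (f a , f b) ⊎ e ≡ (f b , f a)

  realises? : ∀ e g → Dec (Realises e g)
  realises? e (a , b) = ≡-dec _≟_ _≟_ e (f a , f b) ⊎-dec ≡-dec _≟_ _≟_ e (f b , f a)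

  realiser-unique : ∀ {e g h} → Ordered g → Ordered h → Realises e g → Realises e h → g ≡ h
  realiser-unique {e} {a , b} {c , d} a<b c<d = cases
    where
    pair-inj : ∀ {a b c d} → (f a , f b) ≡ (f c , f d) → (a , b) ≡ (c , d)
    pair-inj eq with ,-injective eq
    ... | fa≡fc , fb≡fd = cong₂ _,_ (f-inj fa≡fc) (f-inj fb≡fd)
    not-flipped : (a , b) ≢ (d , c)
    not-flipped refl = <ᶠ-asym a<b c<d
    cases : Realises e (a , b) → Realises e (c , d) → (a , b) ≡ (c , d)
    cases (inj₁ refl) (inj₁ eq) = pair-inj eq
    cases (inj₁ refl) (inj₂ eq) = ⊥-elim (not-flipped (pair-inj eq))
    cases (inj₂ refl) (inj₁ eq) = ⊥-elim (not-flipped (cong swap (pair-inj eq)))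
    cases (inj₂ refl) (inj₂ eq) = cong swap (pair-inj eq)

  embeds-after-cuts : ∀ {EH EG g EH′ e EG′} → Embeds EH EG →
    (g , EH′) ∈ picks EH → (e , EG′) ∈ picks EG → (∀ {h} → h ∈ EH′ → ¬ Realises e h) →
    Embeds EH′ EG′
  embeds-after-cuts {EG = EG} {EH′ = EH′} {EG′ = EG′} emb pg pe unrealised = record
    { unique    = Unique.tail (picks-unique pg (unique emb))
    ; ordered   = All.tail (All-resp-↭ (picks-↭ pg) (ordered emb))
    ; preserved = λ ab∈EH′ → survives ab∈EH′ (preserved emb (∈-picks-rest pg ab∈EH′))
    }
    where
    survives : ∀ {a b} → (a , b) ∈ EH′ → Adjacent EG (f a) (f b) → Adjacent EG′ (f a) (f b)
    survives ab∈EH′ (inj₁ fab∈EG) with ∈-picks pe fab∈EG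
    ... | inj₁ fab≡e = ⊥-elim (unrealised ab∈EH′ (inj₁ (sym fab≡e)))
    ... | inj₂ fab∈EG′ = inj₁ fab∈EG′
    survives ab∈EH′ (inj₂ fba∈EG) with ∈-picks pe fba∈EG
    ... | inj₁ fba≡e = ⊥-elim (unrealised ab∈EH′ (inj₂ (sym fba≡e)))
    ... | inj₂ fba∈EG′ = inj₂ fba∈EG′

  cut-response : ∀ {g₀ gs EG e EG′} → Embeds (g₀ ∷ gs) EG → (e , EG′) ∈ picks EG →
    ∃₂ λ g EH′ → (g , EH′) ∈ picks (g₀ ∷ gs) × Embeds EH′ EG′
  cut-response {g₀} {gs} {e = e} emb pe with any? (realises? e) (g₀ ∷ gs)
  ... | no unrealised =
    g₀ , gs , here refl ,
    embeds-after-cuts emb (here refl) pe (λ h∈gs → unrealised ∘ lose (there h∈gs))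
  ... | yes realised with find realised
  ... | g , g∈ , realises-g with picks-complete g∈
  ... | EH′ , pg = g , EH′ , pg , embeds-after-cuts emb pg pe only-g
    where
    only-g : ∀ {h} → h ∈ EH′ → ¬ Realises e h
    only-g h∈EH′ realises-h =
      All.lookup (Unique.head (picks-unique pg (unique emb))) h∈EH′
        (realiser-unique (All.lookup (ordered emb) g∈)
          (All.lookup (ordered emb) (∈-picks-rest pg h∈EH′)) realises-g realises-h)

  mutual
    -- Only G's fuel has to be exact: running out of fuel on the H side only lowers the H value.
    herderVal-mono : ∀ kH {EH EG kG} v → Embeds EH EG → length EG ≡ kG →
      herderVal kH EH v ≤ herderVal kG EG (f v)
    herderVal-mono zero v _ _ = z≤n
    herderVal-mono (suc kH) {[]} v _ _ = z≤n
    herderVal-mono (suc kH) {(a , b) ∷ gs} {[]} v emb _ with preserved emb (here refl)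
    ... | inj₁ ()
    ... | inj₂ ()
    herderVal-mono (suc kH) {g ∷ gs} {e ∷ es} v emb refl =
      if0-mono (nonisolated-preserved (preserved emb)) (minList-map-glb (e , es) _
        λ { {_ , EG′} pe → let (_ , EH′ , ph , emb′) = cut-response emb pe in
              ≤-trans (minList-lb (∈-map⁺ _ ph))
                (s≤s (catVal-mono kH v emb′ (suc-injective (sym (picks-length pe))))) })

    catVal-mono : ∀ kH {EH EG kG} v → Embeds EH EG → length EG ≡ kG →
      catVal kH EH v ≤ catVal kG EG (f v)
    catVal-mono kH v emb len = if0-mono (nonisolated-preserved (preserved emb))
      (maxList-map-mono f (moves-preserved (preserved emb)) (λ w → herderVal-mono kH w emb len))

mainTheorem11 : (H G : Graph) (s : Subgraph H G) →
    (catMax H ≤ catMax G) × (∀ v → catValue H v ≤ catValue G (emb s v))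
mainTheorem11 H G s = catMax-mono , catValue-mono
  where
  open Embedding (emb s) (emb-inj s)
  H-embeds-G : Embeds (edges H) (edges G)
  H-embeds-G = record
    { unique    = distinct H
    ; ordered   = loopless H
    ; preserved = λ {a} {b} ab∈H → emb-adj s a b (inj₁ ab∈H)
    }
  catValue-mono : ∀ v → catValue H v ≤ catValue G (emb s v)
  catValue-mono v = herderVal-mono (length (edges H)) v H-embeds-G refl
  catMax-mono : catMax H ≤ catMax G
  catMax-mono =
    maxList-map-mono {xs = allFin (n H)} {allFin (n G)} (emb s) (λ _ → ∈-allFin _) catValue-mono
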